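{- For any cartesian closed category $\mathbf C$ there exist a set $\Lambda$ and a $\Lambda$-sorted CCC $\iota:\mathbf{CFam}_\Lambda\to\tilde{\mathbf C}$ such that $\mathbf C$ is equivalent to $\tilde{\mathbf C}$.
   Context: For a set $\Lambda$, $\mathrm{Ty}_\Lambda$ is the set of types generated by $T::=1\mid A\ (A\in\Lambda)\mid T\times T\mid T\to T$. $\mathbf{CFam}_\Lambda$ is the free CCC on no function symbols: its objects are the types in $\mathrm{Ty}_\Lambda$, and a morphism $T\to T'$ is an equivalence class of terms-in-context $x:T\vdash t:T'$ of the simply typed $\lambda$-calculus with unit, product and function types (no constants) modulo $\alpha\beta\eta$-equivalence including the rules $\mathsf{pr}_i\langle t_1,t_2\rangle=t_i$ and the $\eta$-rules for functions and products; composition is substitution. A functor between CCCs is strict cartesian closed if it strictly preserves chosen finite products (the canonical comparison map $\langle F\pi_1,\dots,F\pi_n\rangle$ is an identity) and exponentials ($F(Y^X)=FY^{FX}$ and $\lambda(F\mathrm{ev})=\mathrm{id}$). A $\Lambda$-sorted CCC is a CCC $\mathbf C$ with $\mathrm{Ob}(\mathbf C)=\mathrm{Ty}_\Lambda$ together with a strict cartesian closed functor $\iota:\mathbf{CFam}_\Lambda\to\mathbf C$ that is the identity on objects. -}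

module Defs where

open import Level using (Level; _⊔_) renaming (suc to lsuc)
open import Data.List using (List; []; _∷_)
open import Data.Product using (Σ; _,_)
open import Relation.Binary using (Rel; IsEquivalence)

record CatOn {o : Level} (Obj : Set o) (ℓ e : Level) : Set (o ⊔ lsuc (ℓ ⊔ e)) where
  infix  4 _≈_
  infixr 9 _∘_
  field
    Hom       : Obj → Obj → Set ℓ
    _≈_       : ∀ {A B} → Rel (Hom A B) e
    ≈-equiv   : ∀ {A B} → IsEquivalence (_≈_ {A} {B})
    id        : ∀ {A} → Hom A A
    _∘_       : ∀ {A B C} → Hom B C → Hom A B → Hom A C
    ∘-resp-≈  : ∀ {A B C} {f f' : Hom B C} {g g' : Hom A B} →
                f ≈ f' → g ≈ g' → f ∘ g ≈ f' ∘ g'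
    identityˡ : ∀ {A B} {f : Hom A B} → id ∘ f ≈ f
    identityʳ : ∀ {A B} {f : Hom A B} → f ∘ id ≈ f
    assoc     : ∀ {A B C D} {f : Hom A B} {g : Hom B C} {h : Hom C D} →
                (h ∘ g) ∘ f ≈ h ∘ (g ∘ f)

record CCCOn {o ℓ e : Level} {Obj : Set o} (𝒞 : CatOn Obj ℓ e)
             (⊤ : Obj) (_×_ : Obj → Obj → Obj) (_⇒_ : Obj → Obj → Obj)
             : Set (o ⊔ ℓ ⊔ e) where
  open CatOn 𝒞
  field
    !        : ∀ {A} → Hom A ⊤
    !-unique : ∀ {A} (f : Hom A ⊤) → f ≈ !
    π₁       : ∀ {A B} → Hom (A × B) A
    π₂       : ∀ {A B} → Hom (A × B) B
    ⟨_,_⟩    : ∀ {A B C} → Hom C A → Hom C B → Hom C (A × B)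
    π₁-⟨⟩    : ∀ {A B C} {f : Hom C A} {g : Hom C B} → π₁ ∘ ⟨ f , g ⟩ ≈ f
    π₂-⟨⟩    : ∀ {A B C} {f : Hom C A} {g : Hom C B} → π₂ ∘ ⟨ f , g ⟩ ≈ g
    ⟨⟩-unique : ∀ {A B C} {f : Hom C A} {g : Hom C B} {h : Hom C (A × B)} →
                π₁ ∘ h ≈ f → π₂ ∘ h ≈ g → h ≈ ⟨ f , g ⟩
    ev       : ∀ {B C} → Hom ((B ⇒ C) × B) C
    curry    : ∀ {A B C} → Hom (A × B) C → Hom A (B ⇒ C)
    ev-curry : ∀ {A B C} {f : Hom (A × B) C} →
               ev ∘ ⟨ curry f ∘ π₁ , id ∘ π₂ ⟩ ≈ f
    curry-unique : ∀ {A B C} {f : Hom (A × B) C} {h : Hom A (B ⇒ C)} →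
               ev ∘ ⟨ h ∘ π₁ , id ∘ π₂ ⟩ ≈ f → h ≈ curry f

record CCC (o ℓ e : Level) : Set (lsuc (o ⊔ ℓ ⊔ e)) where
  field
    Obj : Set o
    cat : CatOn Obj ℓ e
    ⊤   : Obj
    _×_ : Obj → Obj → Obj
    _⇒_ : Obj → Obj → Obj
    ccc : CCCOn cat ⊤ _×_ _⇒_

record Functor {o₁ ℓ₁ e₁ o₂ ℓ₂ e₂ : Level} {O₁ : Set o₁} {O₂ : Set o₂}
               (𝒞 : CatOn O₁ ℓ₁ e₁) (𝒟 : CatOn O₂ ℓ₂ e₂)
               : Set (o₁ ⊔ ℓ₁ ⊔ e₁ ⊔ o₂ ⊔ ℓ₂ ⊔ e₂) where
  private
    module C = CatOn 𝒞
    module D = CatOn 𝒟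
  field
    F₀       : O₁ → O₂
    F₁       : ∀ {A B} → C.Hom A B → D.Hom (F₀ A) (F₀ B)
    F-resp-≈ : ∀ {A B} {f g : C.Hom A B} → f C.≈ g → F₁ f D.≈ F₁ g
    F-id     : ∀ {A} → F₁ (C.id {A}) D.≈ D.id
    F-∘      : ∀ {A B C} {f : C.Hom A B} {g : C.Hom B C} →
               F₁ (g C.∘ f) D.≈ F₁ g D.∘ F₁ f

idF : ∀ {o ℓ e} {O : Set o} (𝒞 : CatOn O ℓ e) → Functor 𝒞 𝒞
idF 𝒞 = record
  { F₀ = λ X → X ; F₁ = λ f → f ; F-resp-≈ = λ p → p
  ; F-id = IsEquivalence.refl ≈-equiv
  ; F-∘ = IsEquivalence.refl ≈-equiv }
  where open CatOn 𝒞

_∘F_ : ∀ {o₁ ℓ₁ e₁ o₂ ℓ₂ e₂ o₃ ℓ₃ e₃} {O₁ : Set o₁} {O₂ : Set o₂} {O₃ : Set o₃}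
         {𝒞 : CatOn O₁ ℓ₁ e₁} {𝒟 : CatOn O₂ ℓ₂ e₂} {ℰ : CatOn O₃ ℓ₃ e₃} →
         Functor 𝒟 ℰ → Functor 𝒞 𝒟 → Functor 𝒞 ℰ
_∘F_ {ℰ = ℰ} G F = record
  { F₀ = λ X → G.F₀ (F.F₀ X)
  ; F₁ = λ f → G.F₁ (F.F₁ f)
  ; F-resp-≈ = λ p → G.F-resp-≈ (F.F-resp-≈ p)
  ; F-id = E.trans (G.F-resp-≈ F.F-id) G.F-id
  ; F-∘ = E.trans (G.F-resp-≈ F.F-∘) G.F-∘ }
  where
    module F = Functor F
    module G = Functor G
    module E {A} {B} = IsEquivalence (CatOn.≈-equiv ℰ {A} {B})

record NatIso {o₁ ℓ₁ e₁ o₂ ℓ₂ e₂ : Level} {O₁ : Set o₁} {O₂ : Set o₂}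
              {𝒞 : CatOn O₁ ℓ₁ e₁} {𝒟 : CatOn O₂ ℓ₂ e₂}
              (F G : Functor 𝒞 𝒟) : Set (o₁ ⊔ ℓ₁ ⊔ e₁ ⊔ ℓ₂ ⊔ e₂) where
  private
    module C = CatOn 𝒞
    module D = CatOn 𝒟
    module F = Functor F
    module G = Functor G
  field
    η          : ∀ X → D.Hom (F.F₀ X) (G.F₀ X)
    η⁻¹        : ∀ X → D.Hom (G.F₀ X) (F.F₀ X)
    natural    : ∀ {X Y} (f : C.Hom X Y) → η Y D.∘ F.F₁ f D.≈ G.F₁ f D.∘ η X
    isoˡ       : ∀ X → η⁻¹ X D.∘ η X D.≈ D.id
    isoʳ       : ∀ X → η X D.∘ η⁻¹ X D.≈ D.id

record Equivalence {o₁ ℓ₁ e₁ o₂ ℓ₂ e₂ : Level} {O₁ : Set o₁} {O₂ : Set o₂}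
                   (𝒞 : CatOn O₁ ℓ₁ e₁) (𝒟 : CatOn O₂ ℓ₂ e₂)
                   : Set (o₁ ⊔ ℓ₁ ⊔ e₁ ⊔ o₂ ⊔ ℓ₂ ⊔ e₂) where
  field
    F   : Functor 𝒞 𝒟
    G   : Functor 𝒟 𝒞
    GF≅ : NatIso (G ∘F F) (idF 𝒞)
    FG≅ : NatIso (F ∘F G) (idF 𝒟)

-- Simple types over a set of sorts Λ, and the simply typed λ-calculus
-- with unit, products and functions (no constants), intrinsically typed
-- with de Bruijn indices (so α-equivalence is syntactic identity).

module Syntax {o : Level} (Λ : Set o) where

  infixr 7 _`×_
  infixr 6 _`⇒_
  data Ty : Set o where
    `1   : Ty
    base : Λ → Ty
    _`×_ : Ty → Ty → Ty
    _`⇒_ : Ty → Ty → Ty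

  Ctx : Set o
  Ctx = List Ty

  infix 4 _∋_ _⊢_
  data _∋_ : Ctx → Ty → Set o where
    here  : ∀ {Γ A} → (A ∷ Γ) ∋ A
    there : ∀ {Γ A B} → Γ ∋ A → (B ∷ Γ) ∋ A

  data _⊢_ (Γ : Ctx) : Ty → Set o where
    var  : ∀ {A} → Γ ∋ A → Γ ⊢ A
    unit : Γ ⊢ `1
    pair : ∀ {A B} → Γ ⊢ A → Γ ⊢ B → Γ ⊢ A `× B
    fst  : ∀ {A B} → Γ ⊢ A `× B → Γ ⊢ A
    snd  : ∀ {A B} → Γ ⊢ A `× B → Γ ⊢ B
    lam  : ∀ {A B} → (A ∷ Γ) ⊢ B → Γ ⊢ A `⇒ B
    app  : ∀ {A B} → Γ ⊢ A `⇒ B → Γ ⊢ A → Γ ⊢ B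

  Ren : Ctx → Ctx → Set o
  Ren Γ Δ = ∀ {A} → Γ ∋ A → Δ ∋ A

  ext : ∀ {Γ Δ B} → Ren Γ Δ → Ren (B ∷ Γ) (B ∷ Δ)
  ext ρ here      = here
  ext ρ (there x) = there (ρ x)

  rename : ∀ {Γ Δ A} → Ren Γ Δ → Γ ⊢ A → Δ ⊢ A
  rename ρ (var x)    = var (ρ x)
  rename ρ unit       = unit
  rename ρ (pair t u) = pair (rename ρ t) (rename ρ u)
  rename ρ (fst t)    = fst (rename ρ t)
  rename ρ (snd t)    = snd (rename ρ t)
  rename ρ (lam t)    = lam (rename (ext ρ) t)
  rename ρ (app t u)  = app (rename ρ t) (rename ρ u)

  weaken : ∀ {Γ A B} → Γ ⊢ A → (B ∷ Γ) ⊢ A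
  weaken = rename there

  Sub : Ctx → Ctx → Set o
  Sub Γ Δ = ∀ {A} → Γ ∋ A → Δ ⊢ A

  exts : ∀ {Γ Δ B} → Sub Γ Δ → Sub (B ∷ Γ) (B ∷ Δ)
  exts σ here      = var here
  exts σ (there x) = weaken (σ x)

  subst : ∀ {Γ Δ A} → Sub Γ Δ → Γ ⊢ A → Δ ⊢ A
  subst σ (var x)    = σ x
  subst σ unit       = unit
  subst σ (pair t u) = pair (subst σ t) (subst σ u)
  subst σ (fst t)    = fst (subst σ t)
  subst σ (snd t)    = snd (subst σ t)
  subst σ (lam t)    = lam (subst (exts σ) t)
  subst σ (app t u)  = app (subst σ t) (subst σ u)

  single : ∀ {Γ B} → Γ ⊢ B → Sub (B ∷ Γ) Γ
  single u here      = u
  single u (there x) = var x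

  _[_] : ∀ {Γ A B} → (B ∷ Γ) ⊢ A → Γ ⊢ B → Γ ⊢ A
  t [ u ] = subst (single u) t

  infix 4 _≈βη_
  data _≈βη_ {Γ : Ctx} : ∀ {A} → Γ ⊢ A → Γ ⊢ A → Set o where
    ≈refl  : ∀ {A} {t : Γ ⊢ A} → t ≈βη t
    ≈sym   : ∀ {A} {t u : Γ ⊢ A} → t ≈βη u → u ≈βη t
    ≈trans : ∀ {A} {t u v : Γ ⊢ A} → t ≈βη u → u ≈βη v → t ≈βη v
    pair-cong : ∀ {A B} {t t' : Γ ⊢ A} {u u' : Γ ⊢ B} →
                t ≈βη t' → u ≈βη u' → pair t u ≈βη pair t' u'
    fst-cong  : ∀ {A B} {t t' : Γ ⊢ A `× B} → t ≈βη t' → fst t ≈βη fst t'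
    snd-cong  : ∀ {A B} {t t' : Γ ⊢ A `× B} → t ≈βη t' → snd t ≈βη snd t'
    lam-cong  : ∀ {A B} {t t' : (A ∷ Γ) ⊢ B} → t ≈βη t' → lam t ≈βη lam t'
    app-cong  : ∀ {A B} {t t' : Γ ⊢ A `⇒ B} {u u' : Γ ⊢ A} →
                t ≈βη t' → u ≈βη u' → app t u ≈βη app t' u'
    β-fst  : ∀ {A B} {t : Γ ⊢ A} {u : Γ ⊢ B} → fst (pair t u) ≈βη t
    β-snd  : ∀ {A B} {t : Γ ⊢ A} {u : Γ ⊢ B} → snd (pair t u) ≈βη u
    β-lam  : ∀ {A B} {t : (A ∷ Γ) ⊢ B} {u : Γ ⊢ A} → app (lam t) u ≈βη t [ u ]
    η-unit : ∀ {t : Γ ⊢ `1} → t ≈βη unit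
    η-pair : ∀ {A B} {t : Γ ⊢ A `× B} → t ≈βη pair (fst t) (snd t)
    η-lam  : ∀ {A B} {t : Γ ⊢ A `⇒ B} → t ≈βη lam (app (weaken t) (var here))

  -- The free CCC CFam_Λ: objects are types, a morphism S → T is a term
  -- x : S ⊢ t : T (modulo ≈βη); identity is the variable, composition
  -- is substitution.
  CFamHom : Ty → Ty → Set o
  CFamHom S T = (S ∷ []) ⊢ T

  CFam-id : ∀ {S} → CFamHom S S
  CFam-id = var here

  _∘ₛ_ : ∀ {R S T} → CFamHom S T → CFamHom R S → CFamHom R T
  t ∘ₛ u = subst (λ { here → u ; (there ()) }) t

  CFam-π₁ : ∀ {S T} → CFamHom (S `× T) S
  CFam-π₁ = fst (var here)

  CFam-π₂ : ∀ {S T} → CFamHom (S `× T) T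
  CFam-π₂ = snd (var here)

  CFam-ev : ∀ {S T} → CFamHom ((S `⇒ T) `× S) T
  CFam-ev = app (fst (var here)) (snd (var here))

-- Since ι is the identity on objects and strictly preserves
-- the chosen terminal object, products and exponentials, the chosen
-- structure of C̃ on objects is the syntactic one (`1, `×, `⇒).

record SortedCCC {o : Level} (Λ : Set o) (ℓ e : Level) : Set (o ⊔ lsuc (ℓ ⊔ e)) where
  open Syntax Λ
  field
    cat : CatOn Ty ℓ e
    ccc : CCCOn cat `1 _`×_ _`⇒_
  open CatOn cat
  open CCCOn ccc
  field
    ι₁     : ∀ {S T} → CFamHom S T → Hom S T
    ι-resp : ∀ {S T} {t u : CFamHom S T} → t ≈βη u → ι₁ t ≈ ι₁ u
    ι-id   : ∀ {S} → ι₁ (CFam-id {S}) ≈ id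
    ι-∘    : ∀ {R S T} {t : CFamHom S T} {u : CFamHom R S} →
             ι₁ (t ∘ₛ u) ≈ ι₁ t ∘ ι₁ u
    -- strict preservation of chosen finite products: comparison maps are identities
    ι-strict-⊤ : ! {`1} ≈ id
    ι-strict-× : ∀ {S T} → ⟨ ι₁ (CFam-π₁ {S} {T}) , ι₁ (CFam-π₂ {S} {T}) ⟩ ≈ id
    -- strict preservation of exponentials: λ(ι ev) = id
    ι-strict-⇒ : ∀ {S T} → curry (ι₁ (CFam-ev {S} {T})) ≈ id

{-# OPTIONS --safe #-}
module Submission where

open import Defs
open import Level using (_⊔_)
open import Data.Product using (Σ; _,_)
open import Data.List using ([]; _∷_)
open import Relation.Binary using (IsEquivalence; Setoid)
import Relation.Binary.Reasoning.Setoid as SetoidReasoning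

-- Take Λ to be the objects of C and interpret the simply typed λ-calculus in C, each sort
-- denoting itself. Pulling C back along the interpretation ⟦_⟧T : Ty → Ob C gives C̃ with
-- C̃(S, T) = C(⟦ S ⟧T, ⟦ T ⟧T). As ⟦_⟧T sends `1, `× and `⇒ to the chosen terminal object,
-- products and exponentials, C̃ inherits the cartesian closed structure on the nose, and
-- soundness of the interpretation for βη makes t ↦ ⟦ t ⟧ a strict cartesian closed functor
-- ι : CFam → C̃. Finally ⟦ base A ⟧T = A, so C̃ → C is fully faithful and surjective on
-- objects, hence an equivalence.

module CategoryProperties {o ℓ e} {O : Set o} (𝒞 : CatOn O ℓ e) where
  open CatOn 𝒞 public

  hom-setoid : O → O → Setoid ℓ e
  hom-setoid A B = record { Carrier = Hom A B ; _≈_ = _≈_ ; isEquivalence = ≈-equiv }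

  module ≈-Reasoning {A B : O} = SetoidReasoning (hom-setoid A B)
  module ≈-Equiv {A B : O} = IsEquivalence (≈-equiv {A} {B})
  open ≈-Equiv public using (refl; sym; trans)

  ∘-resp-≈ˡ : ∀ {A B C} {f f' : Hom B C} {g : Hom A B} → f ≈ f' → f ∘ g ≈ f' ∘ g
  ∘-resp-≈ˡ p = ∘-resp-≈ p refl

  ∘-resp-≈ʳ : ∀ {A B C} {f : Hom B C} {g g' : Hom A B} → g ≈ g' → f ∘ g ≈ f ∘ g'
  ∘-resp-≈ʳ p = ∘-resp-≈ refl p

  infix 4 _≅_
  record _≅_ (A B : O) : Set (ℓ ⊔ e) where
    field
      from : Hom A B
      to   : Hom B A
      isoˡ : to ∘ from ≈ id
      isoʳ : from ∘ to ≈ id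

  ≅-refl : ∀ {A} → A ≅ A
  ≅-refl = record { from = id ; to = id ; isoˡ = identityˡ ; isoʳ = identityˡ }

  open _≅_

  conjugate : ∀ {A A' B B'} → A' ≅ A → B' ≅ B → Hom A B → Hom A' B'
  conjugate i j h = to j ∘ (h ∘ from i)

  conjugate-id : ∀ {A A'} (i : A' ≅ A) → conjugate i i id ≈ id
  conjugate-id i = trans (∘-resp-≈ʳ identityˡ) (isoˡ i)

  conjugate-∘ : ∀ {A A' B B' C C'} (i : A' ≅ A) (j : B' ≅ B) (k : C' ≅ C)
                {g : Hom A B} {h : Hom B C} →
                conjugate i k (h ∘ g) ≈ conjugate j k h ∘ conjugate i j g
  conjugate-∘ i j k {g} {h} = begin
    to k ∘ ((h ∘ g) ∘ from i)                        ≈⟨ ∘-resp-≈ʳ assoc ⟩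
    to k ∘ (h ∘ (g ∘ from i))                        ≈⟨ ∘-resp-≈ʳ (∘-resp-≈ʳ (sym identityˡ)) ⟩
    to k ∘ (h ∘ (id ∘ (g ∘ from i)))                 ≈⟨ ∘-resp-≈ʳ (∘-resp-≈ʳ (∘-resp-≈ˡ (sym (isoʳ j)))) ⟩
    to k ∘ (h ∘ ((from j ∘ to j) ∘ (g ∘ from i)))    ≈⟨ ∘-resp-≈ʳ (∘-resp-≈ʳ assoc) ⟩
    to k ∘ (h ∘ (from j ∘ (to j ∘ (g ∘ from i))))    ≈⟨ ∘-resp-≈ʳ (sym assoc) ⟩
    to k ∘ ((h ∘ from j) ∘ (to j ∘ (g ∘ from i)))    ≈⟨ sym assoc ⟩
    (to k ∘ (h ∘ from j)) ∘ (to j ∘ (g ∘ from i))    ∎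
    where open ≈-Reasoning

  from-conjugate : ∀ {A A' B B'} (i : A' ≅ A) (j : B' ≅ B) {h : Hom A B} →
                   from j ∘ conjugate i j h ≈ h ∘ from i
  from-conjugate i j = trans (sym assoc) (trans (∘-resp-≈ˡ (isoʳ j)) identityˡ)

module InverseImage {o o' ℓ e} {O : Set o} {O' : Set o'} (𝒞 : CatOn O ℓ e) (f : O' → O) where
  open CategoryProperties 𝒞

  inverseImage : CatOn O' ℓ e
  inverseImage = record
    { Hom = λ X Y → Hom (f X) (f Y)
    ; _≈_ = _≈_ ; ≈-equiv = ≈-equiv ; id = id ; _∘_ = _∘_
    ; ∘-resp-≈ = ∘-resp-≈ ; identityˡ = identityˡ ; identityʳ = identityʳ ; assoc = assoc }

  inverseImage-equivalence : (g : O → O') → (∀ A → f (g A) ≅ A) →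
                             Equivalence 𝒞 inverseImage
  inverseImage-equivalence g split = record
    { F = record
      { F₀ = g
      ; F₁ = conjugate (split _) (split _)
      ; F-resp-≈ = λ p → ∘-resp-≈ʳ (∘-resp-≈ˡ p)
      ; F-id = conjugate-id (split _)
      ; F-∘ = conjugate-∘ (split _) (split _) (split _) }
    ; G = record { F₀ = f ; F₁ = λ h → h ; F-resp-≈ = λ p → p ; F-id = refl ; F-∘ = refl }
    ; GF≅ = record
      { η = λ A → from (split A) ; η⁻¹ = λ A → to (split A)
      ; natural = λ _ → from-conjugate (split _) (split _)
      ; isoˡ = λ A → isoˡ (split A) ; isoʳ = λ A → isoʳ (split A) }
    ; FG≅ = record
      { η = λ X → from (split (f X)) ; η⁻¹ = λ X → to (split (f X))
      ; natural = λ _ → from-conjugate (split _) (split _)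
      ; isoˡ = λ X → isoˡ (split (f X)) ; isoʳ = λ X → isoʳ (split (f X)) }
    }
    where open _≅_

module CartesianClosedProperties {o ℓ e} (C : CCC o ℓ e) where
  open CCC C using (⊤; _×_; cat; ccc)
  open CategoryProperties cat public
  open CCCOn ccc public

  ⟨⟩∘ : ∀ {A B C D} {f : Hom C A} {g : Hom C B} {h : Hom D C} →
        ⟨ f , g ⟩ ∘ h ≈ ⟨ f ∘ h , g ∘ h ⟩
  ⟨⟩∘ = ⟨⟩-unique (trans (sym assoc) (∘-resp-≈ˡ π₁-⟨⟩))
                  (trans (sym assoc) (∘-resp-≈ˡ π₂-⟨⟩))

  ⟨⟩-cong : ∀ {A B C} {f f' : Hom C A} {g g' : Hom C B} →
            f ≈ f' → g ≈ g' → ⟨ f , g ⟩ ≈ ⟨ f' , g' ⟩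
  ⟨⟩-cong p q = ⟨⟩-unique (trans π₁-⟨⟩ p) (trans π₂-⟨⟩ q)

  ⟨π₁,π₂⟩≈id : ∀ {A B} → ⟨ π₁ , π₂ ⟩ ≈ id {A × B}
  ⟨π₁,π₂⟩≈id = sym (⟨⟩-unique identityʳ identityʳ)

  curry-cong : ∀ {A B C} {f f' : Hom (A × B) C} → f ≈ f' → curry f ≈ curry f'
  curry-cong p = curry-unique (trans ev-curry p)

  infixr 7 _⁂_
  _⁂_ : ∀ {A A' B B'} → Hom A A' → Hom B B' → Hom (A × B) (A' × B')
  f ⁂ g = ⟨ f ∘ π₁ , g ∘ π₂ ⟩

  ⁂∘⟨⟩ : ∀ {A A' B B' C} {f : Hom A A'} {g : Hom B B'} {h : Hom C A} {k : Hom C B} →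
         (f ⁂ g) ∘ ⟨ h , k ⟩ ≈ ⟨ f ∘ h , g ∘ k ⟩
  ⁂∘⟨⟩ = trans ⟨⟩∘ (⟨⟩-cong (trans assoc (∘-resp-≈ʳ π₁-⟨⟩))
                             (trans assoc (∘-resp-≈ʳ π₂-⟨⟩)))

  β : ∀ {A A' B C} {f : Hom (A × B) C} {h : Hom A' A} {k : Hom A' B} →
      ev ∘ ⟨ curry f ∘ h , k ⟩ ≈ f ∘ ⟨ h , k ⟩
  β {f = f} {h} {k} = begin
    ev ∘ ⟨ curry f ∘ h , k ⟩          ≈⟨ ∘-resp-≈ʳ (⟨⟩-cong refl (sym identityˡ)) ⟩
    ev ∘ ⟨ curry f ∘ h , id ∘ k ⟩     ≈⟨ ∘-resp-≈ʳ (sym ⁂∘⟨⟩) ⟩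
    ev ∘ ((curry f ⁂ id) ∘ ⟨ h , k ⟩) ≈⟨ sym assoc ⟩
    (ev ∘ (curry f ⁂ id)) ∘ ⟨ h , k ⟩ ≈⟨ ∘-resp-≈ˡ ev-curry ⟩
    f ∘ ⟨ h , k ⟩                     ∎
    where open ≈-Reasoning

  curry-∘ : ∀ {A A' B C} {f : Hom (A × B) C} {h : Hom A' A} →
            curry f ∘ h ≈ curry (f ∘ (h ⁂ id))
  curry-∘ = curry-unique (trans (∘-resp-≈ʳ (⟨⟩-cong assoc refl)) β)

  curry-ev : ∀ {A B} → curry (ev {A} {B}) ≈ id
  curry-ev = sym (curry-unique (trans (∘-resp-≈ʳ (trans (⟨⟩-cong identityˡ identityˡ) ⟨π₁,π₂⟩≈id))
                                      identityʳ))

  unitorˡ⁻¹ : ∀ {A} → Hom A (⊤ × A)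
  unitorˡ⁻¹ = ⟨ ! , id ⟩

  cancel-unitorˡ : ∀ {A B} {f : Hom A B} → (f ∘ π₂) ∘ unitorˡ⁻¹ ≈ f
  cancel-unitorˡ = trans assoc (trans (∘-resp-≈ʳ π₂-⟨⟩) identityʳ)

  ⟨!,⟩∘ : ∀ {A B C} {f : Hom B C} {g : Hom A B} → ⟨ ! , f ⟩ ∘ g ≈ ⟨ ! , f ∘ g ⟩
  ⟨!,⟩∘ = trans ⟨⟩∘ (⟨⟩-cong (!-unique _) refl)

  unitorˡ⁻¹∘ : ∀ {A B} {f : Hom A B} → unitorˡ⁻¹ ∘ f ≈ ⟨ ! , f ⟩
  unitorˡ⁻¹∘ = trans ⟨!,⟩∘ (⟨⟩-cong refl identityˡ)

module Interpretation {o ℓ e l} (C : CCC o ℓ e) {Λ : Set l} (⟦_⟧B : Λ → CCC.Obj C) where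
  open CCC C using (Obj; ⊤; _×_; _⇒_)
  open CartesianClosedProperties C
  open Syntax Λ

  ⟦_⟧T : Ty → Obj
  ⟦ `1 ⟧T     = ⊤
  ⟦ base A ⟧T = ⟦ A ⟧B
  ⟦ S `× T ⟧T = ⟦ S ⟧T × ⟦ T ⟧T
  ⟦ S `⇒ T ⟧T = ⟦ S ⟧T ⇒ ⟦ T ⟧T

  ⟦_⟧C : Ctx → Obj
  ⟦ [] ⟧C    = ⊤
  ⟦ A ∷ Γ ⟧C = ⟦ Γ ⟧C × ⟦ A ⟧T

  ⟦_⟧v : ∀ {Γ A} → Γ ∋ A → Hom ⟦ Γ ⟧C ⟦ A ⟧T
  ⟦ here ⟧v    = π₂
  ⟦ there x ⟧v = ⟦ x ⟧v ∘ π₁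

  ⟦_⟧ : ∀ {Γ A} → Γ ⊢ A → Hom ⟦ Γ ⟧C ⟦ A ⟧T
  ⟦ var x ⟧    = ⟦ x ⟧v
  ⟦ unit ⟧     = !
  ⟦ pair t u ⟧ = ⟨ ⟦ t ⟧ , ⟦ u ⟧ ⟩
  ⟦ fst t ⟧    = π₁ ∘ ⟦ t ⟧
  ⟦ snd t ⟧    = π₂ ∘ ⟦ t ⟧
  ⟦ lam t ⟧    = curry ⟦ t ⟧
  ⟦ app t u ⟧  = ev ∘ ⟨ ⟦ t ⟧ , ⟦ u ⟧ ⟩

  ⟦_⟧s : ∀ {Γ Δ} → Sub Γ Δ → Hom ⟦ Δ ⟧C ⟦ Γ ⟧C
  ⟦_⟧s {[]}    σ = !
  ⟦_⟧s {A ∷ Γ} σ = ⟨ ⟦ (λ x → σ (there x)) ⟧s , ⟦ σ here ⟧ ⟩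

  ids : ∀ {Γ} → Sub Γ Γ
  ids = var

  wk : ∀ {Γ B} → Sub Γ (B ∷ Γ)
  wk x = var (there x)

  ren⇒sub : ∀ {Γ Δ} → Ren Γ Δ → Sub Γ Δ
  ren⇒sub ρ x = var (ρ x)

  ⟦⟧s-∘ : ∀ {Γ Δ Δ'} (σ : Sub Γ Δ) (τ : Sub Γ Δ') {h : Hom ⟦ Δ' ⟧C ⟦ Δ ⟧C} →
          (∀ {A} (x : Γ ∋ A) → ⟦ τ x ⟧ ≈ ⟦ σ x ⟧ ∘ h) → ⟦ τ ⟧s ≈ ⟦ σ ⟧s ∘ h
  ⟦⟧s-∘ {[]}    σ τ p = sym (!-unique _)
  ⟦⟧s-∘ {A ∷ Γ} σ τ p =
    trans (⟨⟩-cong (⟦⟧s-∘ (λ x → σ (there x)) (λ x → τ (there x)) (λ x → p (there x)))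
                   (p here))
          (sym ⟨⟩∘)

  ⟦⟧v∘⟦⟧s : ∀ {Γ Δ A} (σ : Sub Γ Δ) (x : Γ ∋ A) → ⟦ x ⟧v ∘ ⟦ σ ⟧s ≈ ⟦ σ x ⟧
  ⟦⟧v∘⟦⟧s σ here      = π₂-⟨⟩
  ⟦⟧v∘⟦⟧s σ (there x) = trans assoc (trans (∘-resp-≈ʳ π₁-⟨⟩) (⟦⟧v∘⟦⟧s (λ y → σ (there y)) x))

  ⟦ids⟧s≈id : ∀ {Γ} → ⟦ ids {Γ} ⟧s ≈ id
  ⟦wk⟧s≈π₁ : ∀ {Γ B} → ⟦ wk {Γ} {B} ⟧s ≈ π₁

  ⟦ids⟧s≈id {[]}    = sym (!-unique id)
  ⟦ids⟧s≈id {A ∷ Γ} = trans (⟨⟩-cong (⟦wk⟧s≈π₁ {Γ} {A}) refl) ⟨π₁,π₂⟩≈id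

  ⟦wk⟧s≈π₁ {Γ} = trans (⟦⟧s-∘ (ids {Γ}) wk (λ _ → refl))
                       (trans (∘-resp-≈ˡ (⟦ids⟧s≈id {Γ})) identityˡ)

  ⟦ext⟧s : ∀ {Γ Δ B} (ρ : Ren Γ Δ) → ⟦ ren⇒sub (ext {B = B} ρ) ⟧s ≈ ⟦ ren⇒sub ρ ⟧s ⁂ id
  ⟦ext⟧s ρ = ⟨⟩-cong (⟦⟧s-∘ (ren⇒sub ρ) (λ x → var (there (ρ x))) (λ _ → refl)) (sym identityˡ)

  ⟦⟧-rename : ∀ {Γ Δ A} (ρ : Ren Γ Δ) (t : Γ ⊢ A) → ⟦ rename ρ t ⟧ ≈ ⟦ t ⟧ ∘ ⟦ ren⇒sub ρ ⟧s
  ⟦⟧-rename ρ (var x)    = sym (⟦⟧v∘⟦⟧s (ren⇒sub ρ) x)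
  ⟦⟧-rename ρ unit       = sym (!-unique _)
  ⟦⟧-rename ρ (pair t u) = trans (⟨⟩-cong (⟦⟧-rename ρ t) (⟦⟧-rename ρ u)) (sym ⟨⟩∘)
  ⟦⟧-rename ρ (fst t)    = trans (∘-resp-≈ʳ (⟦⟧-rename ρ t)) (sym assoc)
  ⟦⟧-rename ρ (snd t)    = trans (∘-resp-≈ʳ (⟦⟧-rename ρ t)) (sym assoc)
  ⟦⟧-rename ρ (lam t)    =
    trans (curry-cong (trans (⟦⟧-rename (ext ρ) t) (∘-resp-≈ʳ (⟦ext⟧s ρ)))) (sym curry-∘)
  ⟦⟧-rename ρ (app t u)  =
    trans (∘-resp-≈ʳ (trans (⟨⟩-cong (⟦⟧-rename ρ t) (⟦⟧-rename ρ u)) (sym ⟨⟩∘))) (sym assoc)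

  ⟦⟧-weaken : ∀ {Γ A B} (t : Γ ⊢ A) → ⟦ weaken {B = B} t ⟧ ≈ ⟦ t ⟧ ∘ π₁
  ⟦⟧-weaken {Γ} {B = B} t = trans (⟦⟧-rename there t) (∘-resp-≈ʳ (⟦wk⟧s≈π₁ {Γ} {B}))

  ⟦exts⟧s : ∀ {Γ Δ B} (σ : Sub Γ Δ) → ⟦ exts {B = B} σ ⟧s ≈ ⟦ σ ⟧s ⁂ id
  ⟦exts⟧s σ = ⟨⟩-cong (⟦⟧s-∘ σ (λ x → weaken (σ x)) (λ x → ⟦⟧-weaken (σ x))) (sym identityˡ)

  ⟦⟧-subst : ∀ {Γ Δ A} (σ : Sub Γ Δ) (t : Γ ⊢ A) → ⟦ subst σ t ⟧ ≈ ⟦ t ⟧ ∘ ⟦ σ ⟧s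
  ⟦⟧-subst σ (var x)    = sym (⟦⟧v∘⟦⟧s σ x)
  ⟦⟧-subst σ unit       = sym (!-unique _)
  ⟦⟧-subst σ (pair t u) = trans (⟨⟩-cong (⟦⟧-subst σ t) (⟦⟧-subst σ u)) (sym ⟨⟩∘)
  ⟦⟧-subst σ (fst t)    = trans (∘-resp-≈ʳ (⟦⟧-subst σ t)) (sym assoc)
  ⟦⟧-subst σ (snd t)    = trans (∘-resp-≈ʳ (⟦⟧-subst σ t)) (sym assoc)
  ⟦⟧-subst σ (lam t)    =
    trans (curry-cong (trans (⟦⟧-subst (exts σ) t) (∘-resp-≈ʳ (⟦exts⟧s σ)))) (sym curry-∘)
  ⟦⟧-subst σ (app t u)  =
    trans (∘-resp-≈ʳ (trans (⟨⟩-cong (⟦⟧-subst σ t) (⟦⟧-subst σ u)) (sym ⟨⟩∘))) (sym assoc)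

  ⟦⟧-resp-≈βη : ∀ {Γ A} {t u : Γ ⊢ A} → t ≈βη u → ⟦ t ⟧ ≈ ⟦ u ⟧
  ⟦⟧-resp-≈βη ≈refl           = refl
  ⟦⟧-resp-≈βη (≈sym p)        = sym (⟦⟧-resp-≈βη p)
  ⟦⟧-resp-≈βη (≈trans p q)    = trans (⟦⟧-resp-≈βη p) (⟦⟧-resp-≈βη q)
  ⟦⟧-resp-≈βη (pair-cong p q) = ⟨⟩-cong (⟦⟧-resp-≈βη p) (⟦⟧-resp-≈βη q)
  ⟦⟧-resp-≈βη (fst-cong p)    = ∘-resp-≈ʳ (⟦⟧-resp-≈βη p)
  ⟦⟧-resp-≈βη (snd-cong p)    = ∘-resp-≈ʳ (⟦⟧-resp-≈βη p)
  ⟦⟧-resp-≈βη (lam-cong p)    = curry-cong (⟦⟧-resp-≈βη p)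
  ⟦⟧-resp-≈βη (app-cong p q)  = ∘-resp-≈ʳ (⟨⟩-cong (⟦⟧-resp-≈βη p) (⟦⟧-resp-≈βη q))
  ⟦⟧-resp-≈βη β-fst           = π₁-⟨⟩
  ⟦⟧-resp-≈βη β-snd           = π₂-⟨⟩
  ⟦⟧-resp-≈βη {Γ} (β-lam {t = t} {u}) = begin
    ev ∘ ⟨ curry ⟦ t ⟧ , ⟦ u ⟧ ⟩       ≈⟨ ∘-resp-≈ʳ (⟨⟩-cong (sym identityʳ) refl) ⟩
    ev ∘ ⟨ curry ⟦ t ⟧ ∘ id , ⟦ u ⟧ ⟩  ≈⟨ β ⟩
    ⟦ t ⟧ ∘ ⟨ id , ⟦ u ⟧ ⟩             ≈⟨ ∘-resp-≈ʳ (⟨⟩-cong (sym (⟦ids⟧s≈id {Γ})) refl) ⟩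
    ⟦ t ⟧ ∘ ⟦ single u ⟧s              ≈⟨ sym (⟦⟧-subst (single u) t) ⟩
    ⟦ t [ u ] ⟧                        ∎
    where open ≈-Reasoning
  ⟦⟧-resp-≈βη η-unit          = !-unique _
  ⟦⟧-resp-≈βη η-pair          = ⟨⟩-unique refl refl
  ⟦⟧-resp-≈βη (η-lam {t = t}) = curry-unique (∘-resp-≈ʳ (⟨⟩-cong (sym (⟦⟧-weaken t)) identityˡ))

  -- A morphism of CFam lives in the one-variable context [ S ], interpreted as ⊤ × ⟦ S ⟧T.
  ι₁ : ∀ {S T} → CFamHom S T → Hom ⟦ S ⟧T ⟦ T ⟧T
  ι₁ t = ⟦ t ⟧ ∘ unitorˡ⁻¹

  ι₁-∘ : ∀ {R S T} (t : CFamHom S T) (u : CFamHom R S) → ι₁ (t ∘ₛ u) ≈ ι₁ t ∘ ι₁ u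
  ι₁-∘ t u = begin
    ⟦ t ∘ₛ u ⟧ ∘ unitorˡ⁻¹                ≈⟨ ∘-resp-≈ˡ (⟦⟧-subst _ t) ⟩
    (⟦ t ⟧ ∘ ⟨ ! , ⟦ u ⟧ ⟩) ∘ unitorˡ⁻¹    ≈⟨ assoc ⟩
    ⟦ t ⟧ ∘ (⟨ ! , ⟦ u ⟧ ⟩ ∘ unitorˡ⁻¹)    ≈⟨ ∘-resp-≈ʳ (trans ⟨!,⟩∘ (sym unitorˡ⁻¹∘)) ⟩
    ⟦ t ⟧ ∘ (unitorˡ⁻¹ ∘ ι₁ u)            ≈⟨ sym assoc ⟩
    ι₁ t ∘ ι₁ u                           ∎
    where open ≈-Reasoning

  ι₁-π₁ : ∀ {S T} → ι₁ (CFam-π₁ {S} {T}) ≈ π₁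
  ι₁-π₁ = cancel-unitorˡ

  ι₁-π₂ : ∀ {S T} → ι₁ (CFam-π₂ {S} {T}) ≈ π₂
  ι₁-π₂ = cancel-unitorˡ

  ι₁-strict-× : ∀ {S T} → ⟨ ι₁ (CFam-π₁ {S} {T}) , ι₁ (CFam-π₂ {S} {T}) ⟩ ≈ id
  ι₁-strict-× {S} {T} = trans (⟨⟩-cong (ι₁-π₁ {S} {T}) (ι₁-π₂ {S} {T})) ⟨π₁,π₂⟩≈id

  ι₁-ev : ∀ {S T} → ι₁ (CFam-ev {S} {T}) ≈ ev
  ι₁-ev {S} {T} = trans assoc (trans (∘-resp-≈ʳ (trans ⟨⟩∘ (ι₁-strict-× {S `⇒ T} {S}))) identityʳ)

  open InverseImage (CCC.cat C) ⟦_⟧T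

  sortedCCC : SortedCCC Λ ℓ e
  sortedCCC = record
    { cat = inverseImage
    ; ccc = record { CCCOn (CCC.ccc C) }
    ; ι₁ = ι₁
    ; ι-resp = λ p → ∘-resp-≈ˡ (⟦⟧-resp-≈βη p)
    ; ι-id = π₂-⟨⟩
    ; ι-∘ = λ {_ _ _ t u} → ι₁-∘ t u
    ; ι-strict-⊤ = sym (!-unique id)
    ; ι-strict-× = λ {S} {T} → ι₁-strict-× {S} {T}
    ; ι-strict-⇒ = λ {S} {T} → trans (curry-cong (ι₁-ev {S} {T})) curry-ev
    }

mainTheorem2 : ∀ {o ℓ e} (C : CCC o ℓ e) →
    Σ (Set o) (λ Λ →
      Σ (SortedCCC Λ ℓ e) (λ C̃ →
        Equivalence (CCC.cat C) (SortedCCC.cat C̃)))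
mainTheorem2 C =
  Obj , sortedCCC , inverseImage-equivalence base (λ _ → ≅-refl)
  where
    open CCC C using (Obj)
    open CategoryProperties (CCC.cat C) using (≅-refl)
    open Interpretation C (λ A → A)
    open Syntax Obj using (base)
    open InverseImage (CCC.cat C) ⟦_⟧T
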